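{- Let $G = (V,E)$ be a graph which is bicycle-free at radius $r$, and let $G_2$ be a $2$-lift of $G$. Then $G_2$ is bicycle-free at radius $r$.
   Context: The excess of a multigraph $H=(V,E)$ is $\mathrm{exc}(H) = |E| - |V|$. A connected multigraph with excess $-1$ or $0$ is called bicycle-free (at most unicyclic). A multigraph is bicycle-free at radius $r$ if the distance-$r$ neighborhood of every vertex is bicycle-free (equivalently, a breadth-first search of depth $r$ from any vertex encounters at most one back-edge). A $2$-lift of $G$ is determined by an edge-signing $w: E \to \{\pm1\}$: it is the graph with vertex set $V \times \{\pm 1\}$ and edge set $\{\{(u,\sigma),(v,\sigma \cdot w(u,v))\} : \{u,v\} \in E, \sigma \in \{\pm1\}\}$. -}

module Defs where

open import Data.Nat using (ℕ; zero; suc; _+_; _≤_)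
open import Data.Bool using (Bool; true; false; _∧_; _∨_; not; if_then_else_)
open import Data.Fin using (Fin; zero; suc; _≟_; _↑ˡ_; _↑ʳ_; splitAt)
open import Data.Product using (_×_; _,_; proj₁; proj₂)
open import Data.Sum using (inj₁; inj₂)
open import Relation.Nullary.Decidable using (⌊_⌋)

-- A finite multigraph: vertices Fin nV, edges Fin nE (indexed, so parallel
-- edges and loops are allowed); each edge has two endpoints.
record Multigraph : Set where
  field
    nV   : ℕ
    nE   : ℕ
    ends : Fin nE → Fin nV × Fin nV
open Multigraph public

countTrue : ∀ {k} → (Fin k → Bool) → ℕ
countTrue {zero}  p = 0
countTrue {suc k} p = (if p zero then 1 else 0) + countTrue (λ i → p (suc i))

anyFin : ∀ {k} → (Fin k → Bool) → Bool
anyFin {zero}  p = false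
anyFin {suc k} p = p zero ∨ anyFin (λ i → p (suc i))

ball : (G : Multigraph) → Fin (nV G) → ℕ → Fin (nV G) → Bool
ball G v zero    w = ⌊ w ≟ v ⌋
ball G v (suc k) w =
  ball G v k w ∨
  anyFin (λ e → (ball G v k (proj₁ (ends G e)) ∧ ⌊ proj₂ (ends G e) ≟ w ⌋)
              ∨ (ball G v k (proj₂ (ends G e)) ∧ ⌊ proj₁ (ends G e) ≟ w ⌋))

ballEdge : (G : Multigraph) → Fin (nV G) → ℕ → Fin (nE G) → Bool
ballEdge G v r e = ball G v r (proj₁ (ends G e)) ∧ ball G v r (proj₂ (ends G e))

-- Excess of the ball is at most 0 (the ball is always connected).
BicycleFreeBallAt : (G : Multigraph) → ℕ → Fin (nV G) → Set
BicycleFreeBallAt G r v = countTrue (ballEdge G v r) ≤ countTrue (ball G v r)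

BicycleFreeAt : Multigraph → ℕ → Set
BicycleFreeAt G r = ∀ v → BicycleFreeBallAt G r v

-- Signs: true = +1, false = -1.
signMul : Bool → Bool → Bool
signMul σ w = if w then σ else not σ

-- Vertex (v, σ) of the lift, with V × {±1} encoded as Fin (n + n).
liftVertex : ∀ {n} → Fin n → Bool → Fin (n + n)
liftVertex {n} v true  = v ↑ˡ n
liftVertex {n} v false = n ↑ʳ v

-- 2-lift of G along the signing w: edge (e, σ) with e = {u,v} joins
-- (u, σ) and (v, σ · w(e)); edges indexed by Fin (m + m) ≅ E × {±1}.
twoLift : (G : Multigraph) → (Fin (nE G) → Bool) → Multigraph
twoLift G w = record
  { nV = nV G + nV G
  ; nE = nE G + nE G
  ; ends = λ i → edge (splitAt (nE G) i)
  }
  where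
  edgeσ : Fin (nE G) → Bool → Fin (nV G + nV G) × Fin (nV G + nV G)
  edgeσ e σ = liftVertex (proj₁ (ends G e)) σ , liftVertex (proj₂ (ends G e)) (signMul σ (w e))
  edge : _ → Fin (nV G + nV G) × Fin (nV G + nV G)
  edge (inj₁ e) = edgeσ e true
  edge (inj₂ e) = edgeσ e false

-- Let B be the r-ball around v in G and B′ the r-ball around a lift (v, σ) in the 2-lift.
-- Projection maps B′ onto B, so |B′| ≥ |B| + |A|, where A ⊆ B is the set of vertices both of
-- whose lifts lie in B′. An edge of G has at most one lift inside B′ unless both its ends lie
-- in A, so |E(B′)| ≤ |E(B)| + |E(A)|. Finally |E(A)| ≤ |A|: a breadth-first search tree of B
-- charges every vertex of B ∖ A to a distinct edge of B that is not inside A, hence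
-- |B| - |A| ≤ |E(B)| - |E(A)|, and |E(B)| ≤ |B|. Together |E(B′)| ≤ |B| + |A| ≤ |B′|.

module Submission where

open import Defs
open import Data.Nat using (ℕ; zero; suc; _+_; _≤_; _<_; _≤′_; z≤n; s≤s; ≤′-refl; ≤′-step)
open import Data.Nat.Properties
  using ( module ≤-Reasoning; ≤-refl; ≤-reflexive; ≤-trans; <⇒≤; <-asym; ≤⇒≤′; ≤′⇒≤; m≤n⇒m≤1+n
        ; +-mono-≤; +-monoˡ-≤; +-monoʳ-≤; +-assoc; +-cancelʳ-≤; suc-injective; +-commutativeSemigroup )
open import Data.Bool using (Bool; true; false; _∧_; _∨_; not; if_then_else_; T)
open import Data.Bool.Properties using (T-∧; T-∨)
open import Data.Fin using (Fin; zero; suc; _≟_; _↑ˡ_; _↑ʳ_; splitAt; join)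
open import Data.Fin.Properties using (0≢1+n; splitAt-↑ˡ; splitAt-↑ʳ; join-splitAt)
import Data.Fin.Properties as Fin
open import Data.Product using (∃; ∃₂; _×_; _,_; proj₁; proj₂; map)
open import Data.Product.Properties using (,-injectiveˡ; ,-injectiveʳ)
open import Data.Sum using (_⊎_; inj₁; inj₂; [_,_]′)
open import Data.Empty using (⊥-elim)
open import Function using (id; _∘_; _⇔_; Equivalence; mk⇔)
open import Relation.Nullary using (¬_; yes; no)
open import Relation.Nullary.Decidable using (⌊_⌋; T?; toWitness; fromWitness)
open import Induction.WellFounded using (Acc; acc)
open import Data.Nat.Induction using (<-wellFounded)
open import Relation.Binary.PropositionalEquality
open import Algebra.Properties.CommutativeSemigroup +-commutativeSemigroup using (interchange)

open Equivalence using (to; from)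

-- Written with if_then_else_, as in countTrue, so that countTrue unfolds to it definitionally.
indicator : Bool → ℕ
indicator b = if b then 1 else 0

indicator-mono : ∀ {x y} → (T x → T y) → indicator x ≤ indicator y
indicator-mono {false} _   = z≤n
indicator-mono {true} {y} x⇒y with y | x⇒y _
... | true  | _  = ≤-refl
... | false | ()

indicator-∨-∧ : ∀ x y → indicator x + indicator y ≡ indicator (x ∨ y) + indicator (x ∧ y)
indicator-∨-∧ true  true  = refl
indicator-∨-∧ true  false = refl
indicator-∨-∧ false true  = refl
indicator-∨-∧ false false = refl

module _ {k : ℕ} where

  infixl 6 _∖_
  _∖_ : (Fin k → Bool) → (Fin k → Bool) → Fin k → Bool
  (q ∖ p) i = q i ∧ not (p i)

  _⊆_ : (Fin k → Bool) → (Fin k → Bool) → Set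
  p ⊆ q = ∀ {i} → T (p i) → T (q i)

T-∖ : ∀ {k} (q p : Fin k → Bool) {i} → T ((q ∖ p) i) ⇔ (T (q i) × ¬ T (p i))
T-∖ q p {i} with q i | p i
... | true  | true  = mk⇔ (λ ()) (λ (_ , ¬pᵢ) → ¬pᵢ _)
... | true  | false = mk⇔ (λ _ → _ , λ ()) _
... | false | _     = mk⇔ (λ ()) proj₁

countTrue-cong : ∀ {k} {p q : Fin k → Bool} → (∀ i → p i ≡ q i) → countTrue p ≡ countTrue q
countTrue-cong {zero}  p≗q = refl
countTrue-cong {suc k} p≗q = cong₂ (λ b n → indicator b + n) (p≗q zero) (countTrue-cong (p≗q ∘ suc))

countTrue-false : ∀ {k} → countTrue {k} (λ _ → false) ≡ 0
countTrue-false {zero}  = refl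
countTrue-false {suc k} = countTrue-false {k}

countTrue-mono₂ : ∀ {k} (p₁ p₂ q₁ q₂ : Fin k → Bool) →
  (∀ i → indicator (p₁ i) + indicator (p₂ i) ≤ indicator (q₁ i) + indicator (q₂ i)) →
  countTrue p₁ + countTrue p₂ ≤ countTrue q₁ + countTrue q₂
countTrue-mono₂ {zero}  _ _ _ _ _ = z≤n
countTrue-mono₂ {suc k} p₁ p₂ q₁ q₂ h =
  subst₂ _≤_ (interchange (indicator (p₁ zero)) (indicator (p₂ zero)) _ _)
             (interchange (indicator (q₁ zero)) (indicator (q₂ zero)) _ _)
    (+-mono-≤ (h zero) (countTrue-mono₂ (p₁ ∘ suc) (p₂ ∘ suc) (q₁ ∘ suc) (q₂ ∘ suc) (h ∘ suc)))

countTrue-∖ : ∀ {k} {p q : Fin k → Bool} → p ⊆ q → countTrue p + countTrue (q ∖ p) ≡ countTrue q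
countTrue-∖ {zero}          p⊆q = refl
countTrue-∖ {suc k} {p} {q} p⊆q = begin
  (indicator (p zero) + countTrue (p ∘ suc)) + (indicator ((q ∖ p) zero) + countTrue ((q ∖ p) ∘ suc))
    ≡⟨ interchange (indicator (p zero)) _ _ _ ⟩
  (indicator (p zero) + indicator ((q ∖ p) zero)) + (countTrue (p ∘ suc) + countTrue ((q ∖ p) ∘ suc))
    ≡⟨ cong₂ _+_ (indicator-∖ (p zero) (q zero) p⊆q) (countTrue-∖ {p = p ∘ suc} {q ∘ suc} p⊆q) ⟩
  indicator (q zero) + countTrue (q ∘ suc) ∎
  where
  open ≡-Reasoning
  indicator-∖ : ∀ x y → (T x → T y) → indicator x + indicator (y ∧ not x) ≡ indicator y
  indicator-∖ true  y     x⇒y with y | x⇒y _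
  ... | true  | _  = refl
  ... | false | ()
  indicator-∖ false true  _ = refl
  indicator-∖ false false _ = refl

countTrue-↑ : ∀ a b (p : Fin (a + b) → Bool) →
  countTrue p ≡ countTrue (λ i → p (i ↑ˡ b)) + countTrue (λ i → p (a ↑ʳ i))
countTrue-↑ zero    b p = refl
countTrue-↑ (suc a) b p =
  trans (cong (indicator (p zero) +_) (countTrue-↑ a b (p ∘ suc))) (sym (+-assoc (indicator (p zero)) _ _))

countTrue-singleton : ∀ {k} (j : Fin k) → countTrue (λ i → ⌊ i ≟ j ⌋) ≡ 1
countTrue-singleton {suc k} zero    = cong suc (countTrue-false {k})
countTrue-singleton {suc k} (suc j) = trans (countTrue-cong λ i → does-suc≟suc i) (countTrue-singleton j)
  where
  does-suc≟suc : ∀ i → ⌊ suc i ≟ suc j ⌋ ≡ ⌊ i ≟ j ⌋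
  does-suc≟suc i with i ≟ j
  ... | yes _ = refl
  ... | no  _ = refl

countTrue-witness : ∀ {k} (p : Fin k → Bool) → countTrue p ≡ 0 ⊎ ∃ λ i → T (p i)
countTrue-witness {zero}  p = inj₁ refl
countTrue-witness {suc k} p with p zero in p₀ | countTrue-witness (p ∘ suc)
... | true  | _              = inj₂ (zero , subst T (sym p₀) _)
... | false | inj₁ zero-true = inj₁ zero-true
... | false | inj₂ (i , pᵢ)  = inj₂ (suc i , pᵢ)

countTrue-injection : ∀ {n m} (p : Fin n → Bool) (q : Fin m → Bool)
  (f : ∀ i → T (p i) → Fin m) →
  (∀ i pᵢ → T (q (f i pᵢ))) →
  (∀ i j pᵢ pⱼ → f i pᵢ ≡ f j pⱼ → i ≡ j) →
  countTrue p ≤ countTrue q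
countTrue-injection {zero}  p q f f∈q f-inj = z≤n
countTrue-injection {suc n} {m} p q f f∈q f-inj with p zero in p₀
... | false = countTrue-injection (p ∘ suc) q (f ∘ suc) (f∈q ∘ suc)
                (λ i j pᵢ pⱼ eq → Fin.suc-injective (f-inj (suc i) (suc j) pᵢ pⱼ eq))
... | true  = subst (suc (countTrue (p ∘ suc)) ≤_) count-q
  (s≤s (countTrue-injection (p ∘ suc) (q ∖ ≡e₀) (f ∘ suc) f∈q∖e₀
    (λ i j pᵢ pⱼ eq → Fin.suc-injective (f-inj (suc i) (suc j) pᵢ pⱼ eq))))
  where
  e₀ : Fin m
  e₀ = f zero (subst T (sym p₀) _)
  ≡e₀ : Fin m → Bool
  ≡e₀ e = ⌊ e ≟ e₀ ⌋
  ≡e₀-sound : ∀ {e} → T (≡e₀ e) → e ≡ e₀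
  ≡e₀-sound {e} = toWitness {a? = e ≟ e₀}
  count-q : suc (countTrue (q ∖ ≡e₀)) ≡ countTrue q
  count-q = trans (cong (_+ countTrue (q ∖ ≡e₀)) (sym (countTrue-singleton e₀)))
                  (countTrue-∖ {p = ≡e₀} λ e≡e₀ → subst (T ∘ q) (sym (≡e₀-sound e≡e₀)) (f∈q zero _))
  f∈q∖e₀ : ∀ i pᵢ → T ((q ∖ ≡e₀) (f (suc i) pᵢ))
  f∈q∖e₀ i pᵢ = from (T-∖ q ≡e₀)
    (f∈q (suc i) pᵢ , λ fᵢ≡e₀ → 0≢1+n (f-inj zero (suc i) _ pᵢ (sym (≡e₀-sound fᵢ≡e₀))))

T-anyFin : ∀ {k} {p : Fin k → Bool} → T (anyFin p) ⇔ ∃ λ i → T (p i)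
T-anyFin {k} {p} = mk⇔ (witness p) (λ (i , pᵢ) → intro p i pᵢ)
  where
  witness : ∀ {k} (p : Fin k → Bool) → T (anyFin p) → ∃ λ i → T (p i)
  witness {suc k} p h with to (T-∨ {p zero}) h
  ... | inj₁ p₀ = zero , p₀
  ... | inj₂ ps with witness (p ∘ suc) ps
  ...   | i , pᵢ = suc i , pᵢ
  intro : ∀ {k} (p : Fin k → Bool) i → T (p i) → T (anyFin p)
  intro p zero    pᵢ = from (T-∨ {p zero}) (inj₁ pᵢ)
  intro p (suc i) pᵢ = from (T-∨ {p zero}) (inj₂ (intro (p ∘ suc) i pᵢ))

data Joins (G : Multigraph) (e : Fin (nE G)) (x y : Fin (nV G)) : Set where
  forward  : ends G e ≡ (x , y) → Joins G e x y
  backward : ends G e ≡ (y , x) → Joins G e x y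

Joins-unique : ∀ {G e x y x′ y′} → Joins G e x y → Joins G e x′ y′ →
  y ≡ y′ ⊎ (x ≡ y′ × y ≡ x′)
Joins-unique (forward eq)  (forward eq′)  = inj₁ (,-injectiveʳ (trans (sym eq) eq′))
Joins-unique (backward eq) (backward eq′) = inj₁ (,-injectiveˡ (trans (sym eq) eq′))
Joins-unique (forward eq)  (backward eq′) =
  inj₂ (,-injectiveˡ (trans (sym eq) eq′) , ,-injectiveʳ (trans (sym eq) eq′))
Joins-unique (backward eq) (forward eq′)  =
  inj₂ (,-injectiveʳ (trans (sym eq) eq′) , ,-injectiveˡ (trans (sym eq) eq′))

induced : (G : Multigraph) → (Fin (nV G) → Bool) → Fin (nE G) → Bool
induced G A e = A (proj₁ (ends G e)) ∧ A (proj₂ (ends G e))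

T-induced : ∀ {G} (A : Fin (nV G) → Bool) {e x y} → Joins G e x y →
  T (induced G A e) ⇔ (T (A x) × T (A y))
T-induced A (forward eq)  rewrite eq = T-∧
T-induced A (backward eq) rewrite eq =
  mk⇔ (λ h → let (a , b) = to T-∧ h in b , a) (λ (a , b) → from T-∧ (b , a))

module Ball (G : Multigraph) (v : Fin (nV G)) where

  ball-center : T (ball G v 0 v)
  ball-center = fromWitness refl

  ball-zero : ∀ {u} → T (ball G v 0 u) → u ≡ v
  ball-zero = toWitness

  ball-step : ∀ k {u} → T (ball G v k u) → T (ball G v (suc k) u)
  ball-step k h = from T-∨ (inj₁ h)

  ball-mono : ∀ {j k u} → j ≤ k → T (ball G v j u) → T (ball G v k u)
  ball-mono j≤k = go (≤⇒≤′ j≤k)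
    where
    go : ∀ {j k u} → j ≤′ k → T (ball G v j u) → T (ball G v k u)
    go ≤′-refl              h = h
    go (≤′-step {k} j≤′k) h = ball-step k (go j≤′k h)

  ball-suc⁺ : ∀ k {e x y} → Joins G e x y → T (ball G v k x) → T (ball G v (suc k) y)
  ball-suc⁺ k {e} {y = y} (forward eq) h =
    from T-∨ (inj₂ (from T-anyFin (e , from T-∨ (inj₁ edge-in))))
    where
    edge-in : T (ball G v k (proj₁ (ends G e)) ∧ ⌊ proj₂ (ends G e) ≟ y ⌋)
    edge-in rewrite eq = from T-∧ (h , fromWitness refl)
  ball-suc⁺ k {e} {y = y} (backward eq) h =
    from T-∨ (inj₂ (from T-anyFin (e , from T-∨ (inj₂ edge-in))))
    where
    edge-in : T (ball G v k (proj₂ (ends G e)) ∧ ⌊ proj₁ (ends G e) ≟ y ⌋)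
    edge-in rewrite eq = from T-∧ (h , fromWitness refl)

  ball-suc⁻ : ∀ k {y} → T (ball G v (suc k) y) →
    T (ball G v k y) ⊎ ∃₂ λ e x → Joins G e x y × T (ball G v k x)
  ball-suc⁻ k h with to T-∨ h
  ... | inj₁ h′ = inj₁ h′
  ... | inj₂ h′ with to T-anyFin h′
  ...   | e , h″ with to T-∨ h″
  ...     | inj₁ h‴ = let (bx , eqy) = to T-∧ h‴ in
                      inj₂ (e , _ , forward (cong (_ ,_) (toWitness eqy)) , bx)
  ...     | inj₂ h‴ = let (bx , eqy) = to T-∧ h‴ in
                      inj₂ (e , _ , backward (cong (_, _) (toWitness eqy)) , bx)

  -- depth u k = min (dist v u) k: the layer of u in a breadth-first search truncated at k.
  depth : Fin (nV G) → ℕ → ℕ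
  depth u zero    = zero
  depth u (suc k) = if ball G v k u then depth u k else suc k

  depth-step : ∀ u k → (T (ball G v k u) × depth u (suc k) ≡ depth u k)
                     ⊎ (¬ T (ball G v k u) × depth u (suc k) ≡ suc k)
  depth-step u k with ball G v k u
  ... | true  = inj₁ (_ , refl)
  ... | false = inj₂ ((λ ()) , refl)

  depth-≤ : ∀ u k → depth u k ≤ k
  depth-≤ u zero    = z≤n
  depth-≤ u (suc k) with depth-step u k
  ... | inj₁ (_ , d) = subst (_≤ suc k) (sym d) (m≤n⇒m≤1+n (depth-≤ u k))
  ... | inj₂ (_ , d) = subst (_≤ suc k) (sym d) ≤-refl

  ball-depth : ∀ {u} k → T (ball G v k u) → T (ball G v (depth u k) u)
  ball-depth         zero    h = h
  ball-depth {u = u} (suc k) h with depth-step u k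
  ... | inj₁ (bk , d) = subst (λ i → T (ball G v i u)) (sym d) (ball-depth k bk)
  ... | inj₂ (_  , d) = subst (λ i → T (ball G v i u)) (sym d) h

  depth-minimal : ∀ {u j} k → j ≤ k → T (ball G v j u) → depth u k ≤ j
  depth-minimal {u} {j} k j≤k = go (≤⇒≤′ j≤k)
    where
    go : ∀ {k} → j ≤′ k → T (ball G v j u) → depth u k ≤ j
    go ≤′-refl h = depth-≤ u j
    go (≤′-step {k} j≤′k) h with depth-step u k
    ... | inj₁ (_ , d)   = subst (_≤ j) (sym d) (go j≤′k h)
    ... | inj₂ (¬bk , _) = ⊥-elim (¬bk (ball-mono (≤′⇒≤ j≤′k) h))

  depth-suc : ∀ {u j} k → depth u k ≡ suc j → ¬ T (ball G v j u)
  depth-suc {u} (suc k) d with depth-step u k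
  ... | inj₁ (_ , d′)   = depth-suc k (trans (sym d′) d)
  ... | inj₂ (¬bk , d′) = subst (λ i → ¬ T (ball G v i u)) (suc-injective (trans (sym d′) d)) ¬bk

  module _ (r : ℕ) where

    record Parent (u : Fin (nV G)) : Set where
      field
        vertex : Fin (nV G)
        edge   : Fin (nE G)
        joins  : Joins G edge vertex u
        closer : depth vertex r < depth u r
        inBall : T (ball G v r vertex)

    parent : ∀ {u} → T (ball G v r u) → u ≢ v → Parent u
    parent {u} bu u≢v with depth u r in d | ball-depth r bu
    ... | zero  | b₀ = ⊥-elim (u≢v (ball-zero b₀))
    ... | suc k | b with ball-suc⁻ k b
    ...   | inj₁ bk                  = ⊥-elim (depth-suc r d bk)
    ...   | inj₂ (e , x , joins , bx) = record
      { vertex = x ; edge = e ; joins = joins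
      ; closer = subst (depth x r <_) (sym d) (s≤s (depth-minimal r k≤r bx))
      ; inBall = ball-mono k≤r bx
      }
      where
      k≤r : k ≤ r
      k≤r = <⇒≤ (subst (_≤ r) d (depth-≤ u r))

    parent-injective : ∀ {x y} (P : Parent x) (Q : Parent y) → Parent.edge P ≡ Parent.edge Q → x ≡ y
    parent-injective P Q same-edge
      with Joins-unique (Parent.joins P) (subst (λ e → Joins G e _ _) (sym same-edge) (Parent.joins Q))
    ... | inj₁ x≡y = x≡y
    ... | inj₂ (refl , refl) = ⊥-elim (<-asym (Parent.closer P) (Parent.closer Q))

    module _ (A : Fin (nV G) → Bool) (A⊆ball : A ⊆ ball G v r) where

      record Exit : Set where
        field
          inner   : Fin (nV G)
          step    : Parent inner
          inner∈A : T (A inner)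
          outer∉A : ¬ T (A (Parent.vertex step))

      descend : ∀ a → Acc _<_ (depth a r) → T (A a) → T (A v) ⊎ Exit
      descend a (acc rec) a∈A with a ≟ v
      ... | yes refl = inj₁ a∈A
      ... | no  a≢v  = continue (parent (A⊆ball a∈A) a≢v)
        where
        continue : Parent a → T (A v) ⊎ Exit
        continue P with T? (A (Parent.vertex P))
        ... | yes p∈A = descend _ (rec (Parent.closer P)) p∈A
        ... | no  p∉A = inj₂ (record { inner = a ; step = P ; inner∈A = a∈A ; outer∉A = p∉A })

      -- A vertex u of the ball outside A is charged to the parent edge of u, or, if u is the
      -- root, to the edge by which a search path from A towards the root leaves A.
      record Escape (u : Fin (nV G)) : Set where
        field
          origin     : Fin (nV G)
          step       : Parent origin
          inBallEdge : T (ballEdge G v r (Parent.edge step))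
          leaves     : ¬ T (induced G A (Parent.edge step))
          anchored   : origin ≡ u ⊎ (u ≡ v × T (A origin))

      escape : ∃ (T ∘ A) → ∀ {u} → T (ball G v r u) → ¬ T (A u) → Escape u
      escape (a , a∈A) {u} bu u∉A with u ≟ v
      ... | no u≢v = record
        { origin     = u
        ; step       = P
        ; inBallEdge = from (T-induced (ball G v r) (Parent.joins P)) (Parent.inBall P , bu)
        ; leaves     = u∉A ∘ proj₂ ∘ to (T-induced A (Parent.joins P))
        ; anchored   = inj₁ refl
        }
        where P = parent bu u≢v
      ... | yes refl with descend a (<-wellFounded _) a∈A
      ...   | inj₁ v∈A  = ⊥-elim (u∉A v∈A)
      ...   | inj₂ exit = record
        { origin     = inner
        ; step       = step
        ; inBallEdge = from (T-induced (ball G v r) (Parent.joins step)) (Parent.inBall step , A⊆ball inner∈A)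
        ; leaves     = outer∉A ∘ proj₁ ∘ to (T-induced A (Parent.joins step))
        ; anchored   = inj₂ (refl , inner∈A)
        }
        where open Exit exit

      escape-injective : ∀ {x y} → ¬ T (A x) → ¬ T (A y) → (E : Escape x) (F : Escape y) →
        Parent.edge (Escape.step E) ≡ Parent.edge (Escape.step F) → x ≡ y
      escape-injective x∉A y∉A E F same-edge
        with parent-injective (Escape.step E) (Escape.step F) same-edge | Escape.anchored E | Escape.anchored F
      ... | refl | inj₁ refl        | inj₁ refl        = refl
      ... | refl | inj₁ refl        | inj₂ (_ , o∈A)   = ⊥-elim (x∉A o∈A)
      ... | refl | inj₂ (_ , o∈A)   | inj₁ refl        = ⊥-elim (y∉A o∈A)
      ... | refl | inj₂ (refl , _)  | inj₂ (refl , _)  = refl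

      countTrue-ball∖≤ballEdge∖ : ∃ (T ∘ A) →
        countTrue (ball G v r ∖ A) ≤ countTrue (ballEdge G v r ∖ induced G A)
      countTrue-ball∖≤ballEdge∖ a∈A = countTrue-injection _ _
        (λ u h → Parent.edge (Escape.step (escape′ h)))
        (λ u h → from (T-∖ (ballEdge G v r) (induced G A))
                      (Escape.inBallEdge (escape′ h) , Escape.leaves (escape′ h)))
        (λ x y hx hy → escape-injective (∉A hx) (∉A hy) (escape′ hx) (escape′ hy))
        where
        ∉A : ∀ {u} → T ((ball G v r ∖ A) u) → ¬ T (A u)
        ∉A = proj₂ ∘ to (T-∖ (ball G v r) A)
        escape′ : ∀ {u} → T ((ball G v r ∖ A) u) → Escape u
        escape′ h = escape a∈A (proj₁ (to (T-∖ (ball G v r) A) h)) (∉A h)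

      induced-excess≤0 : BicycleFreeBallAt G r v → countTrue (induced G A) ≤ countTrue A
      induced-excess≤0 bf with countTrue-witness (induced G A)
      ... | inj₁ none          = subst (_≤ countTrue A) (sym none) z≤n
      ... | inj₂ (e , e∈induced) = +-cancelʳ-≤ (countTrue (ballEdge G v r ∖ induced G A)) _ _ (begin
        countTrue (induced G A) + countTrue (ballEdge G v r ∖ induced G A)
          ≡⟨ countTrue-∖ {p = induced G A} induced⊆ballEdge ⟩
        countTrue (ballEdge G v r)
          ≤⟨ bf ⟩
        countTrue (ball G v r)
          ≡⟨ countTrue-∖ {p = A} A⊆ball ⟨
        countTrue A + countTrue (ball G v r ∖ A)
          ≤⟨ +-monoʳ-≤ (countTrue A) (countTrue-ball∖≤ballEdge∖ (_ , proj₁ (to T-∧ e∈induced))) ⟩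
        countTrue A + countTrue (ballEdge G v r ∖ induced G A) ∎)
        where
        open ≤-Reasoning
        induced⊆ballEdge : induced G A ⊆ ballEdge G v r
        induced⊆ballEdge {e} h = let (a₁ , a₂) = to T-∧ h in from T-∧ (A⊆ball a₁ , A⊆ball a₂)

module _ {n : ℕ} where

  lift⁺ lift⁻ : Fin n → Fin (n + n)
  lift⁺ u = liftVertex u true
  lift⁻ u = liftVertex u false

  project : Fin (n + n) → Fin n
  project x = [ id , id ]′ (splitAt n x)

  project-liftVertex : ∀ u s → project (liftVertex u s) ≡ u
  project-liftVertex u true  rewrite splitAt-↑ˡ n u n = refl
  project-liftVertex u false rewrite splitAt-↑ʳ n n u = refl

  liftVertex-surjective : ∀ x → ∃₂ λ u s → liftVertex u s ≡ x
  liftVertex-surjective x with splitAt n x in eq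
  ... | inj₁ u = u , true  , trans (cong (join n n) (sym eq)) (join-splitAt n n x)
  ... | inj₂ u = u , false , trans (cong (join n n) (sym eq)) (join-splitAt n n x)

signMul-involutive : ∀ s b → signMul (signMul s b) b ≡ s
signMul-involutive s     true  = refl
signMul-involutive true  false = refl
signMul-involutive false false = refl

T-∧-signMul : ∀ (P : Bool → Bool) b →
  T (P (signMul true b)) → T (P (signMul false b)) → T (P true ∧ P false)
T-∧-signMul P true  p₁ p₂ = from T-∧ (p₁ , p₂)
T-∧-signMul P false p₁ p₂ = from T-∧ (p₂ , p₁)

module Lift (G : Multigraph) (w : Fin (nE G) → Bool) where

  H : Multigraph
  H = twoLift G w

  ends-lift : ∀ e s → ends H (liftVertex e s) ≡
    (liftVertex (proj₁ (ends G e)) s , liftVertex (proj₂ (ends G e)) (signMul s (w e)))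
  ends-lift e true  rewrite splitAt-↑ˡ (nE G) e (nE G) = refl
  ends-lift e false rewrite splitAt-↑ʳ (nE G) (nE G) e = refl

  ends-project : ∀ e s {a b} → ends H (liftVertex e s) ≡ (a , b) → ends G e ≡ (project a , project b)
  ends-project e s eq = begin
    ends G e
      ≡⟨ cong₂ _,_ (project-liftVertex _ s) (project-liftVertex _ (signMul s (w e))) ⟨
    map project project (liftVertex (proj₁ (ends G e)) s , liftVertex (proj₂ (ends G e)) (signMul s (w e)))
      ≡⟨ cong (map project project) (ends-lift e s) ⟨
    map project project (ends H (liftVertex e s))
      ≡⟨ cong (map project project) eq ⟩
    (project _ , project _) ∎
    where open ≡-Reasoning

  Joins-project : ∀ {e s x y} → Joins H (liftVertex e s) x y → Joins G e (project x) (project y)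
  Joins-project {e} {s} (forward eq)  = forward  (ends-project e s eq)
  Joins-project {e} {s} (backward eq) = backward (ends-project e s eq)

  Joins-lift : ∀ {e x y} → Joins G e x y → ∀ s →
    ∃₂ λ i t → Joins H i (liftVertex x s) (liftVertex y t)
  Joins-lift {e} (forward eq) s =
    liftVertex e s , signMul s (w e) ,
    forward (trans (ends-lift e s)
                   (cong (λ p → liftVertex (proj₁ p) s , liftVertex (proj₂ p) (signMul s (w e))) eq))
  Joins-lift {e} (backward eq) s =
    liftVertex e t , t ,
    backward (trans (ends-lift e t) (cong₂ _,_ (cong (λ p → liftVertex (proj₁ p) t) eq)
                                                (cong₂ liftVertex (cong proj₂ eq) (signMul-involutive s (w e)))))
    where t = signMul s (w e)

  module _ (v : Fin (nV G)) (σ : Bool) where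

    private
      module BG = Ball G v
      module BH = Ball H (liftVertex v σ)

    ball-project : ∀ k {x} → T (ball H (liftVertex v σ) k x) → T (ball G v k (project x))
    ball-project zero h rewrite BH.ball-zero h | project-liftVertex v σ = BG.ball-center
    ball-project (suc k) h with BH.ball-suc⁻ k h
    ... | inj₁ h′ = BG.ball-step k (ball-project k h′)
    ... | inj₂ (i , y , joins , by) with liftVertex-surjective {nE G} i
    ...   | e , s , refl = BG.ball-suc⁺ k (Joins-project {e} {s} joins) (ball-project k by)

    ball-lift : ∀ k {u} → T (ball G v k u) → ∃ λ s → T (ball H (liftVertex v σ) k (liftVertex u s))
    ball-lift zero h rewrite BG.ball-zero h = σ , BH.ball-center
    ball-lift (suc k) {u} h with BG.ball-suc⁻ k h
    ... | inj₁ h′ = map id (BH.ball-step k) (ball-lift k h′)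
    ... | inj₂ (e , x , joins , bx) with ball-lift k bx
    ...   | s , bxs with Joins-lift joins s
    ...     | i , t , joins′ = t , BH.ball-suc⁺ k joins′ bxs

    module _ (r : ℕ) where

      private
        B′ : Fin (nV H) → Bool
        B′ = ball H (liftVertex v σ) r

      bothLifts : Fin (nV G) → Bool
      bothLifts u = B′ (lift⁺ u) ∧ B′ (lift⁻ u)

      lifted-inBall : ∀ {u} s → T (B′ (liftVertex u s)) → T (ball G v r u)
      lifted-inBall {u} s h = subst (T ∘ ball G v r) (project-liftVertex u s) (ball-project r h)

      bothLifts⊆ball : bothLifts ⊆ ball G v r
      bothLifts⊆ball h = lifted-inBall true (proj₁ (to T-∧ h))

      countTrue-liftedBall : countTrue (ball G v r) + countTrue bothLifts ≤ countTrue B′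
      countTrue-liftedBall = ≤-trans
        (countTrue-mono₂ (ball G v r) bothLifts (B′ ∘ lift⁺) (B′ ∘ lift⁻) per-vertex)
        (≤-reflexive (sym (countTrue-↑ (nV G) (nV G) B′)))
        where
        ball⇒some-lift : ∀ {u} → T (ball G v r u) → T (B′ (lift⁺ u) ∨ B′ (lift⁻ u))
        ball⇒some-lift h with ball-lift r h
        ... | true  , h′ = from T-∨ (inj₁ h′)
        ... | false , h′ = from T-∨ (inj₂ h′)
        per-vertex : ∀ u → indicator (ball G v r u) + indicator (bothLifts u)
                         ≤ indicator (B′ (lift⁺ u)) + indicator (B′ (lift⁻ u))
        per-vertex u = ≤-trans (+-monoˡ-≤ _ (indicator-mono ball⇒some-lift))
                               (≤-reflexive (sym (indicator-∨-∧ (B′ (lift⁺ u)) _)))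

      countTrue-liftedBallEdge :
        countTrue (ballEdge H (liftVertex v σ) r) ≤ countTrue (ballEdge G v r) + countTrue (induced G bothLifts)
      countTrue-liftedBallEdge = ≤-trans (≤-reflexive (countTrue-↑ (nE G) (nE G) E′))
        (countTrue-mono₂ (E′ ∘ lift⁺) (E′ ∘ lift⁻) (ballEdge G v r) (induced G bothLifts) per-edge)
        where
        E′ : Fin (nE H) → Bool
        E′ = ballEdge H (liftVertex v σ) r
        lifted-ends : ∀ {e} s → T (E′ (liftVertex e s)) →
          T (B′ (liftVertex (proj₁ (ends G e)) s)) × T (B′ (liftVertex (proj₂ (ends G e)) (signMul s (w e))))
        lifted-ends {e} s = to (T-induced {H} B′ (forward (ends-lift e s)))
        lifted-inBallEdge : ∀ {e} s → T (E′ (liftVertex e s)) → T (ballEdge G v r e)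
        lifted-inBallEdge {e} s h =
          let (b₁ , b₂) = lifted-ends s h in from T-∧ (lifted-inBall s b₁ , lifted-inBall (signMul s (w e)) b₂)
        some-lift⇒ballEdge : ∀ {e} → T (E′ (lift⁺ e) ∨ E′ (lift⁻ e)) → T (ballEdge G v r e)
        some-lift⇒ballEdge = [ lifted-inBallEdge true , lifted-inBallEdge false ]′ ∘ to T-∨
        both-lifts⇒induced : ∀ {e} → T (E′ (lift⁺ e) ∧ E′ (lift⁻ e)) → T (induced G bothLifts e)
        both-lifts⇒induced {e} h =
          let (h₊ , h₋) = to T-∧ h
              (a₊ , b₊) = lifted-ends true h₊
              (a₋ , b₋) = lifted-ends false h₋
          in from T-∧ (from T-∧ (a₊ , a₋) , T-∧-signMul (B′ ∘ liftVertex (proj₂ (ends G e))) (w e) b₊ b₋)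
        per-edge : ∀ e → indicator (E′ (lift⁺ e)) + indicator (E′ (lift⁻ e))
                       ≤ indicator (ballEdge G v r e) + indicator (induced G bothLifts e)
        per-edge e = ≤-trans (≤-reflexive (indicator-∨-∧ (E′ (lift⁺ e)) _))
                             (+-mono-≤ (indicator-mono some-lift⇒ballEdge) (indicator-mono both-lifts⇒induced))

      lift-bicycleFree : BicycleFreeBallAt G r v → BicycleFreeBallAt H r (liftVertex v σ)
      lift-bicycleFree bf = begin
        countTrue (ballEdge H (liftVertex v σ) r)
          ≤⟨ countTrue-liftedBallEdge ⟩
        countTrue (ballEdge G v r) + countTrue (induced G bothLifts)
          ≤⟨ +-mono-≤ bf (BG.induced-excess≤0 r bothLifts bothLifts⊆ball bf) ⟩
        countTrue (ball G v r) + countTrue bothLifts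
          ≤⟨ countTrue-liftedBall ⟩
        countTrue B′ ∎
        where open ≤-Reasoning

proposition2p12 : (G : Multigraph) (r : ℕ) (w : Fin (nE G) → Bool) →
    BicycleFreeAt G r → BicycleFreeAt (twoLift G w) r
proposition2p12 G r w bf x with liftVertex-surjective {nV G} x
... | v , σ , refl = Lift.lift-bicycleFree G w v σ r (bf v)
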